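{- Let $k\ge 1$ and $r\ge 2$ be integers. Then $$g_2(k,r)=\begin{cases} r\binom{k}{\lfloor k/2\rfloor} & \text{if } k\ge 3 \text{ and } r\ne 2,\\[2pt] \binom{k}{\lfloor k/2\rfloor}+\binom{k}{\lfloor k/2+1\rfloor} & \text{if } r=2,\\[2pt] 2r-1 & \text{if } k=2.\end{cases}$$
   Context: Model 2 (non-adaptive, $r+2$ players $A,B,C_1,\dots,C_r$ with $r>1$). Player $A$ chooses an unknown defective element $d$ of a finite set $X$. A query is an ordered $r$-tuple $(X_1,\dots,X_r)$ of pairwise disjoint subsets of $X$ whose union is $X$ (a partition of $X$ into $r$ sets); Player $B$ chooses all $k$ queries at once. For each query $(X_1,\dots,X_r)$, if $d\in X_i$ then Player $C_i$ is given the set $X_i$ (i.e. a YES answer together with the set); the players $C_i$ have no other information about the queries. Player $C_i$ can identify $d$ iff $d$ is the unique element of $X$ contained in every set given to $C_i$ (if $C_i$ is given no sets, this means $X=\{d\}$). A collection of queries solves Model 2 if for every choice of $d\in X$ at least one player $C_i$ can identify $d$. $g_2(k,r)$ denotes the largest $n$ such that on an $n$-element set there are $k$ queries solving Model 2. -}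

module Defs where

open import Data.Nat using (ℕ; _≤_)
open import Data.Fin using (Fin)
open import Data.Product using (Σ; ∃; _×_)
open import Relation.Binary.PropositionalEquality using (_≡_)

-- A non-adaptive family of k queries on X = Fin n: query j is an ordered
-- partition (X_1,…,X_r) of X, encoded as the map sending x to the index of
-- the block containing x (X_i = {x | Q j x ≡ i}; blocks may be empty).
Queries : ℕ → ℕ → ℕ → Set
Queries k n r = Fin k → Fin n → Fin r

-- Player C_i is given the sets X_i of exactly those queries j with d ∈ X_i,
-- i.e. Q j d ≡ i.  C_i identifies d iff d is the unique element lying in every
-- set given to C_i (no sets given: the intersection is X, so X = {d}).
Identifies : ∀ {k n r} → Queries k n r → Fin r → Fin n → Set
Identifies Q i d = ∀ x → (∀ j → Q j d ≡ i → Q j x ≡ i) → x ≡ d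

SolvesModel2 : ∀ {k n r} → Queries k n r → Set
SolvesModel2 {r = r} Q = ∀ d → ∃ λ (i : Fin r) → Identifies Q i d

Solvable : ℕ → ℕ → ℕ → Set
Solvable k r n = Σ (Queries k n r) SolvesModel2

IsG2 : ℕ → ℕ → ℕ → Set
IsG2 k r m = Solvable k r m × (∀ n → Solvable k r n → n ≤ m)

-- Let Aᵢ(d) be the set of queries whose i-th block contains d. Player Cᵢ identifies d
-- iff Aᵢ(d) ⊄ Aᵢ(x) for every x ≠ d, so the elements identified by Cᵢ have pairwise
-- incomparable sets Aᵢ. Each chain of the symmetric chain decomposition of the Boolean
-- lattice meets such a family at most once, and there are C(k,⌊k/2⌋) chains, whence
-- n ≤ r·C(k,⌊k/2⌋). For r = 2, A₁ is the complement of A₀, so along the chains of the sets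
-- A₀ each chain carries at most one element identified by each player, and a one-member
-- chain at most one element; there are C(k,⌊k/2⌋+1) chains with two or more members. The bounds are attained by r copies of the ⌈k/2⌉-subsets with complements
-- painted in two further colours, by the two middle levels when r = 2, and by the first
-- row and column of the grid when k = 2.

module Submission where

open import Defs
open import Data.Nat using (ℕ; _≤_; _*_; _+_; _∸_; _/_; suc)
open import Data.Nat.Combinatorics using (_C_)
open import Data.Product using (_×_)
open import Relation.Binary.PropositionalEquality using (_≡_; _≢_)

open import Data.Nat
  using (zero; pred; _<_; s≤s; z≤n; s≤s⁻¹; ⌊_/2⌋; ⌈_/2⌉; _≤?_; _<?_)
open import Data.Nat.Properties
  using ( +-cancelʳ-≤; +-comm; +-identityʳ; +-mono-≤; +-monoˡ-≤; +-suc; +-∸-assoc; 1+n≢n; 1+n≰n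
        ; <-≤-trans; <⇒≤; <⇒≱; m+n∸m≡n; m+n∸n≡m; m≤m+n; m≤n⇒m≤1+n; n≤1+n; ∸-monoʳ-<; ∸-monoˡ-≤
        ; ≤-<-trans; ≤-antisym; ≤-refl; ≤-reflexive; ≤-total; ≤-trans; ≮⇒≥; ≰⇒>
        ; ⌈n/2⌉-mono; ⌊n/2⌋+⌈n/2⌉≡n; ⌊n/2⌋≤n; ⌊n/2⌋≤⌈n/2⌉; module ≤-Reasoning )
open import Data.Nat.DivMod using (m/n≡1+[m∸n]/n)
open import Data.Nat.Combinatorics using (nCk≡nC[n∸k]; nCk+nC[k+1]≡[n+1]C[k+1])
open import Data.Bool using (Bool; true; false)
open import Data.Fin using (Fin; zero; suc; punchIn; punchOut; join; splitAt; combine; remQuot; _≟_)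
open import Data.Fin.Properties
  using ( injective⇒≤; punchOut-injective; punchIn-injective; punchInᵢ≢i; 0≢1+n; suc-injective
        ; all?; ¬∀⟶∃¬; splitAt-join; join-splitAt; combine-remQuot )
open import Data.Fin.Subset using (Subset; inside; outside; ∣_∣; _⊆_; _∈_; ∁)
open import Data.Fin.Subset.Properties
  using (drop-∷-⊆; out⊆; in⊆in; p⊆q⇒∣p∣≤∣q∣; ⊆-antisym; ⊆-reflexive; ∁p⊆∁q⇒p⊇q; ∣∁p∣≡n∸∣p∣)
open import Data.List as List using (List; []; _∷_; [_]; _++_; length; map; filter; cartesianProduct; allFin)
open import Data.List.Properties using (length-++; length-map; length-tabulate; filter-++; filter-all; filter-none; filter-≐)
open import Data.List.Membership.Propositional using () renaming (_∈_ to _∈ˡ_)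
open import Data.List.Membership.Propositional.Properties
  using (∈-map⁺; ∈-map⁻; ∈-++⁺ˡ; ∈-++⁺ʳ; ∈-filter⁺; ∈-cartesianProduct⁺; ∈-allFin; ∈-lookup)
open import Data.List.Relation.Unary.All as All using (All; []; _∷_)
open import Data.List.Relation.Unary.All.Properties using (++⁺; map⁺; all-filter)
open import Data.List.Relation.Unary.Unique.Propositional using (Unique)
import Data.List.Relation.Unary.Unique.Propositional.Properties as Unique
open import Data.List.Relation.Unary.AllPairs using ([]; _∷_)
open import Data.List.Relation.Unary.Any as Any using (here)
open import Data.List.Relation.Unary.Any.Properties using (lookup-index)
open import Data.Product using (_,_; proj₁; proj₂; ∃; uncurry)
open import Data.Product.Properties using (,-injectiveˡ; ,-injectiveʳ)
open import Data.Sum using (_⊎_; inj₁; inj₂; [_,_]′)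
open import Data.Sum.Properties using (inj₁-injective; inj₂-injective)
open import Data.Vec as Vec using (Vec; []; _∷_; tabulate)
open import Data.Vec.Properties
  using (∷-injectiveˡ; ∷-injectiveʳ; lookup∘tabulate; []=⇒lookup; lookup⇒[]=; tabulate-∘; tabulate∘lookup)
open import Function using (_∘_; id; flip; case_of_)
open import Function.Definitions using (Injective)
open import Relation.Nullary using (Dec; yes; no; does; ¬_; contradiction)
open import Relation.Unary using (Pred; Decidable) renaming (_⊆_ to _⊆ᵘ_)
open import Relation.Nullary.Decidable using (_→-dec_; dec-true; dec-false)
open import Relation.Binary.PropositionalEquality
  using (refl; sym; trans; cong; cong₂; subst; subst₂; module ≡-Reasoning)

n/2≡⌊n/2⌋ : ∀ n → n / 2 ≡ ⌊ n /2⌋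
n/2≡⌊n/2⌋ zero = refl
n/2≡⌊n/2⌋ (suc zero) = refl
n/2≡⌊n/2⌋ (suc (suc n)) =
  trans (m/n≡1+[m∸n]/n {suc (suc n)} {2} (s≤s (s≤s z≤n))) (cong suc (n/2≡⌊n/2⌋ n))

m≤⌊n/2⌋⇒m+m≤n : ∀ {m n} → m ≤ ⌊ n /2⌋ → m + m ≤ n
m≤⌊n/2⌋⇒m+m≤n {m} {n} m≤ = begin
  m + m                 ≤⟨ +-mono-≤ m≤ (≤-trans m≤ (⌊n/2⌋≤⌈n/2⌉ n)) ⟩
  ⌊ n /2⌋ + ⌈ n /2⌉     ≡⟨ ⌊n/2⌋+⌈n/2⌉≡n n ⟩
  n                     ∎
  where open ≤-Reasoning

m+m≤n⇒m≤⌊n/2⌋ : ∀ {m n} → m + m ≤ n → m ≤ ⌊ n /2⌋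
m+m≤n⇒m≤⌊n/2⌋ {zero} _ = z≤n
m+m≤n⇒m≤⌊n/2⌋ {suc m} {suc (suc n)} m+m≤n =
  s≤s (m+m≤n⇒m≤⌊n/2⌋ (s≤s⁻¹ (s≤s⁻¹ (subst (_≤ suc (suc n)) (cong suc (+-suc m m)) m+m≤n))))
m+m≤n⇒m≤⌊n/2⌋ {suc m} {suc zero} m+m≤n =
  contradiction (subst (_≤ 1) (cong suc (+-suc m m)) m+m≤n) λ { (s≤s ()) }

m+m≤1+n+n⇒m≤n : ∀ {m n} → m + m ≤ suc (n + n) → m ≤ n
m+m≤1+n+n⇒m≤n {m} {n} m+m≤ with m ≤? n
... | yes m≤n = m≤n
... | no m≰n = contradiction (s≤s⁻¹ (≤-trans (+-mono-≤ n<m n<m) m+m≤))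
                             (1+n≰n ∘ subst (_≤ n + n) (+-suc n n))
  where n<m = ≰⇒> m≰n

n∸⌊n/2⌋≡⌈n/2⌉ : ∀ n → n ∸ ⌊ n /2⌋ ≡ ⌈ n /2⌉
n∸⌊n/2⌋≡⌈n/2⌉ n = begin
  n ∸ ⌊ n /2⌋                     ≡⟨ cong (_∸ ⌊ n /2⌋) (sym (⌊n/2⌋+⌈n/2⌉≡n n)) ⟩
  ⌊ n /2⌋ + ⌈ n /2⌉ ∸ ⌊ n /2⌋     ≡⟨ m+n∸m≡n ⌊ n /2⌋ ⌈ n /2⌉ ⟩
  ⌈ n /2⌉                         ∎
  where open ≡-Reasoning

nC⌊n/2⌋≡nC⌈n/2⌉ : ∀ n → n C ⌊ n /2⌋ ≡ n C ⌈ n /2⌉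
nC⌊n/2⌋≡nC⌈n/2⌉ n = trans (nCk≡nC[n∸k] (⌊n/2⌋≤n n)) (cong (n C_) (n∸⌊n/2⌋≡⌈n/2⌉ n))

module _ {a p} {A : Set a} {P : Pred A p} (P? : Decidable P) where

  length-filter-map : ∀ {B : Set a} (f : B → A) xs →
    length (filter P? (map f xs)) ≡ length (filter (P? ∘ f) xs)
  length-filter-map f [] = refl
  length-filter-map f (x ∷ xs) with does (P? (f x))
  ... | true = cong suc (length-filter-map f xs)
  ... | false = length-filter-map f xs

  filter-filter-⊆ : ∀ {q} {Q : Pred A q} (Q? : Decidable Q) → P ⊆ᵘ Q → ∀ xs →
    filter P? (filter Q? xs) ≡ filter P? xs
  filter-filter-⊆ Q? P⊆Q [] = refl
  filter-filter-⊆ Q? P⊆Q (x ∷ xs) with Q? x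
  ... | yes _ with P? x
  ...   | yes _ = cong (x ∷_) (filter-filter-⊆ Q? P⊆Q xs)
  ...   | no _  = filter-filter-⊆ Q? P⊆Q xs
  filter-filter-⊆ Q? P⊆Q (x ∷ xs) | no ¬qx with P? x
  ...   | yes px = contradiction (P⊆Q px) ¬qx
  ...   | no _   = filter-filter-⊆ Q? P⊆Q xs

∈-injective⇒≤length : ∀ {A : Set} {n} {xs : List A} (f : Fin n → A) →
  Injective _≡_ _≡_ f → (∀ i → f i ∈ˡ xs) → n ≤ length xs
∈-injective⇒≤length {xs = xs} f f-injective f∈ = injective⇒≤ {f = Any.index ∘ f∈} λ {i} {j} index≡ →
  f-injective (trans (lookup-index (f∈ i)) (trans (cong (List.lookup xs) index≡) (sym (lookup-index (f∈ j)))))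

injective-avoiding⇒≤ : ∀ {m n} (f : Fin n → Fin (suc m)) {y} →
  Injective _≡_ _≡_ f → (∀ i → f i ≢ y) → n ≤ m
injective-avoiding⇒≤ f f-injective avoids = injective⇒≤ {f = λ i → punchOut (avoids i ∘ sym)} λ {i} {j} →
  f-injective ∘ punchOut-injective (avoids i ∘ sym) (avoids j ∘ sym)

join-injective : ∀ m n → Injective _≡_ _≡_ (join m n)
join-injective m n {x} {y} eq = trans (sym (splitAt-join m n x)) (trans (cong (splitAt m) eq) (splitAt-join m n y))

remQuot-injective : ∀ {m} n → Injective _≡_ _≡_ (remQuot {m} n)
remQuot-injective {m} n {x} {y} eq =
  trans (sym (combine-remQuot {m} n x)) (trans (cong (uncurry combine) eq) (combine-remQuot {m} n y))

lookup-injective : ∀ {A : Set} {xs : List A} → Unique xs → Injective _≡_ _≡_ (List.lookup xs)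
lookup-injective (_ ∷ _) {zero} {zero} _ = refl
lookup-injective (x∉ ∷ _) {zero} {suc j} eq = contradiction eq (All.lookup x∉ (∈-lookup j))
lookup-injective (x∉ ∷ _) {suc i} {zero} eq = contradiction (sym eq) (All.lookup x∉ (∈-lookup i))
lookup-injective (_ ∷ unique) {suc i} {suc j} eq = cong suc (lookup-injective unique eq)

length-cartesianProduct : ∀ {A B : Set} (xs : List A) (ys : List B) →
  length (cartesianProduct xs ys) ≡ length xs * length ys
length-cartesianProduct [] ys = refl
length-cartesianProduct (x ∷ xs) ys = begin
  length (map (x ,_) ys ++ cartesianProduct xs ys)
    ≡⟨ length-++ (map (x ,_) ys) ⟩
  length (map (x ,_) ys) + length (cartesianProduct xs ys)
    ≡⟨ cong₂ _+_ (length-map (x ,_) ys) (length-cartesianProduct xs ys) ⟩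
  length ys + length xs * length ys ∎
  where open ≡-Reasoning

⊆∧∣∣≥⇒≡ : ∀ {k} {p q : Subset k} → p ⊆ q → ∣ q ∣ ≤ ∣ p ∣ → p ≡ q
⊆∧∣∣≥⇒≡ {p = []} {[]} _ _ = refl
⊆∧∣∣≥⇒≡ {p = outside ∷ p} {outside ∷ q} p⊆q q≤p =
  cong (outside ∷_) (⊆∧∣∣≥⇒≡ (drop-∷-⊆ p⊆q) q≤p)
⊆∧∣∣≥⇒≡ {p = inside ∷ p} {inside ∷ q} p⊆q q≤p =
  cong (inside ∷_) (⊆∧∣∣≥⇒≡ (drop-∷-⊆ p⊆q) (s≤s⁻¹ q≤p))
⊆∧∣∣≥⇒≡ {p = inside ∷ p} {outside ∷ q} p⊆q _ with p⊆q Vec.here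
... | ()
⊆∧∣∣≥⇒≡ {p = outside ∷ p} {inside ∷ q} p⊆q q≤p =
  contradiction q≤p (<⇒≱ (s≤s (p⊆q⇒∣p∣≤∣q∣ (drop-∷-⊆ p⊆q))))

subsetsOfSize : (k s : ℕ) → List (Subset k)
subsetsOfSize zero zero = [ [] ]
subsetsOfSize zero (suc s) = []
subsetsOfSize (suc k) zero = map (outside ∷_) (subsetsOfSize k zero)
subsetsOfSize (suc k) (suc s) = map (inside ∷_) (subsetsOfSize k s) ++ map (outside ∷_) (subsetsOfSize k (suc s))

length-subsetsOfSize : ∀ k s → length (subsetsOfSize k s) ≡ k C s
length-subsetsOfSize zero zero = refl
length-subsetsOfSize zero (suc s) = refl
length-subsetsOfSize (suc k) zero = trans (length-map _ (subsetsOfSize k zero)) (length-subsetsOfSize k zero)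
length-subsetsOfSize (suc k) (suc s) = begin
  length (map (inside ∷_) (subsetsOfSize k s) ++ map (outside ∷_) (subsetsOfSize k (suc s)))
    ≡⟨ length-++ (map (inside ∷_) (subsetsOfSize k s)) ⟩
  length (map (inside ∷_) (subsetsOfSize k s)) + length (map (outside ∷_) (subsetsOfSize k (suc s)))
    ≡⟨ cong₂ _+_ (trans (length-map _ (subsetsOfSize k s)) (length-subsetsOfSize k s))
                 (trans (length-map _ (subsetsOfSize k (suc s))) (length-subsetsOfSize k (suc s))) ⟩
  k C s + k C suc s
    ≡⟨ nCk+nC[k+1]≡[n+1]C[k+1] k s ⟩
  suc k C suc s ∎
  where open ≡-Reasoning

∣subsetsOfSize∣ : ∀ k s → All (λ p → ∣ p ∣ ≡ s) (subsetsOfSize k s)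
∣subsetsOfSize∣ zero zero = refl ∷ []
∣subsetsOfSize∣ zero (suc s) = []
∣subsetsOfSize∣ (suc k) zero = map⁺ (∣subsetsOfSize∣ k zero)
∣subsetsOfSize∣ (suc k) (suc s) =
  ++⁺ (map⁺ (All.map (cong suc) (∣subsetsOfSize∣ k s))) (map⁺ (∣subsetsOfSize∣ k (suc s)))

subsetsOfSize-unique : ∀ k s → Unique (subsetsOfSize k s)
subsetsOfSize-unique zero zero = [] ∷ []
subsetsOfSize-unique zero (suc s) = []
subsetsOfSize-unique (suc k) zero = Unique.map⁺ ∷-injectiveʳ (subsetsOfSize-unique k zero)
subsetsOfSize-unique (suc k) (suc s) = Unique.++⁺
  (Unique.map⁺ ∷-injectiveʳ (subsetsOfSize-unique k s))
  (Unique.map⁺ ∷-injectiveʳ (subsetsOfSize-unique k (suc s)))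
  λ (∈ins , ∈outs) → case ∈-map⁻ (inside ∷_) ∈ins , ∈-map⁻ (outside ∷_) ∈outs of λ where
    ((_ , _ , refl) , (_ , _ , eq)) → contradiction (∷-injectiveˡ eq) λ ()

-- Symmetric chain decomposition of the Boolean lattice

-- The chain with bottom c has k + 1 − 2∣c∣ members; it is long if it has at least two.
IsLong : ∀ {k} → Subset k → Set
IsLong {k} c = ∣ c ∣ + ∣ c ∣ < k

isLong? : ∀ {k} → Decidable (IsLong {k})
isLong? {k} c = ∣ c ∣ + ∣ c ∣ <? k

-- de Bruijn's decomposition, grown by a new first coordinate: each chain c₀ ⊂ … ⊂ c_h of
-- Subset k yields 0c₀ ⊂ … ⊂ 0c_h ⊂ 1c_h and 1c₀ ⊂ … ⊂ 1c_{h−1}. A chain is named by its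
-- bottom; the test asks whether the tail p lies below the top of its chain.
chainBottom : ∀ {k} → Subset k → Subset k
chainBottom [] = []
chainBottom (outside ∷ p) = outside ∷ chainBottom p
chainBottom {suc k} (inside ∷ p) with ∣ p ∣ + ∣ chainBottom p ∣ <? k
... | yes _ = inside ∷ chainBottom p
... | no _ = outside ∷ chainBottom p

chainBottom-bounds : ∀ {k} (p : Subset k) →
  ∣ chainBottom p ∣ ≤ ∣ p ∣ × ∣ p ∣ + ∣ chainBottom p ∣ ≤ k
chainBottom-bounds [] = z≤n , z≤n
chainBottom-bounds (outside ∷ p) with chainBottom-bounds p
... | b≤p , p+b≤k = b≤p , m≤n⇒m≤1+n p+b≤k
chainBottom-bounds {suc k} (inside ∷ p) with ∣ p ∣ + ∣ chainBottom p ∣ <? k | chainBottom-bounds p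
... | yes p+b<k | b≤p , _ = s≤s b≤p , s≤s (subst (_≤ k) (sym (+-suc (∣ p ∣) (∣ chainBottom p ∣))) p+b<k)
... | no _ | b≤p , p+b≤k = m≤n⇒m≤1+n b≤p , s≤s p+b≤k

≤top : ∀ {k} (p q : Subset k) → chainBottom p ≡ chainBottom q →
  ¬ ∣ q ∣ + ∣ chainBottom q ∣ < k → ∣ p ∣ ≤ ∣ q ∣
≤top {k} p q same q-top = +-cancelʳ-≤ (∣ chainBottom q ∣) (∣ p ∣) (∣ q ∣) (begin
  ∣ p ∣ + ∣ chainBottom q ∣   ≡⟨ cong (λ c → ∣ p ∣ + ∣ c ∣) (sym same) ⟩
  ∣ p ∣ + ∣ chainBottom p ∣   ≤⟨ proj₂ (chainBottom-bounds p) ⟩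
  k                           ≤⟨ ≮⇒≥ q-top ⟩
  ∣ q ∣ + ∣ chainBottom q ∣   ∎)
  where open ≤-Reasoning

sameChain⇒⊆ : ∀ {k} (p q : Subset k) → chainBottom p ≡ chainBottom q → ∣ p ∣ ≤ ∣ q ∣ → p ⊆ q
sameChain⇒⊆ [] [] _ _ = λ ()
sameChain⇒⊆ (outside ∷ p) (outside ∷ q) same p≤q = out⊆ (sameChain⇒⊆ p q (∷-injectiveʳ same) p≤q)
sameChain⇒⊆ {suc k} (outside ∷ p) (inside ∷ q) same p≤q with ∣ q ∣ + ∣ chainBottom q ∣ <? k
... | yes _ = contradiction (∷-injectiveˡ same) λ ()
... | no q-top = out⊆ (sameChain⇒⊆ p q (∷-injectiveʳ same) (≤top p q (∷-injectiveʳ same) q-top))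
sameChain⇒⊆ {suc k} (inside ∷ p) (outside ∷ q) same p<q with ∣ p ∣ + ∣ chainBottom p ∣ <? k
... | yes _ = contradiction (∷-injectiveˡ same) λ ()
... | no p-top = contradiction (≤top q p (sym (∷-injectiveʳ same)) p-top) (<⇒≱ p<q)
sameChain⇒⊆ {suc k} (inside ∷ p) (inside ∷ q) same p≤q
  with ∣ p ∣ + ∣ chainBottom p ∣ <? k | ∣ q ∣ + ∣ chainBottom q ∣ <? k
... | yes _ | yes _ = in⊆in (sameChain⇒⊆ p q (∷-injectiveʳ same) (s≤s⁻¹ p≤q))
... | no _  | no _  = in⊆in (sameChain⇒⊆ p q (∷-injectiveʳ same) (s≤s⁻¹ p≤q))
... | yes _ | no _  = contradiction (∷-injectiveˡ same) λ ()
... | no _  | yes _ = contradiction (∷-injectiveˡ same) λ ()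

short⇒∣p∣≡∣chainBottom∣ : ∀ {k} (p : Subset k) → ¬ IsLong (chainBottom p) →
  ∣ p ∣ ≡ ∣ chainBottom p ∣
short⇒∣p∣≡∣chainBottom∣ {k} p short with chainBottom-bounds p
... | b≤p , p+b≤k = ≤-antisym (+-cancelʳ-≤ b (∣ p ∣) b (≤-trans p+b≤k (≮⇒≥ short))) b≤p
  where b = ∣ chainBottom p ∣

shortChain⇒≡ : ∀ {k} (p q : Subset k) → ¬ IsLong (chainBottom p) → chainBottom p ≡ chainBottom q → p ≡ q
shortChain⇒≡ p q short same = ⊆-antisym (sameChain⇒⊆ p q same (≤-reflexive ∣p∣≡∣q∣))
                                         (sameChain⇒⊆ q p (sym same) (≤-reflexive (sym ∣p∣≡∣q∣)))
  where
  ∣p∣≡∣q∣ : ∣ p ∣ ≡ ∣ q ∣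
  ∣p∣≡∣q∣ = begin
    ∣ p ∣                 ≡⟨ short⇒∣p∣≡∣chainBottom∣ p short ⟩
    ∣ chainBottom p ∣     ≡⟨ cong ∣_∣ same ⟩
    ∣ chainBottom q ∣     ≡⟨ sym (short⇒∣p∣≡∣chainBottom∣ q (subst (¬_ ∘ IsLong) same short)) ⟩
    ∣ q ∣                 ∎
    where open ≡-Reasoning

chainBottoms : (k : ℕ) → List (Subset k)
chainBottoms zero = [ [] ]
chainBottoms (suc k) =
  map (outside ∷_) (chainBottoms k) ++ map (inside ∷_) (filter isLong? (chainBottoms k))

chainBottom∈chainBottoms : ∀ {k} (p : Subset k) → chainBottom p ∈ˡ chainBottoms k
chainBottom∈chainBottoms [] = here refl
chainBottom∈chainBottoms (outside ∷ p) = ∈-++⁺ˡ (∈-map⁺ (outside ∷_) (chainBottom∈chainBottoms p))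
chainBottom∈chainBottoms {suc k} (inside ∷ p) with ∣ p ∣ + ∣ chainBottom p ∣ <? k
... | yes p+b<k = ∈-++⁺ʳ _ (∈-map⁺ (inside ∷_) (∈-filter⁺ isLong? (chainBottom∈chainBottoms p) long))
  where
  long : IsLong (chainBottom p)
  long = ≤-<-trans (+-monoˡ-≤ _ (proj₁ (chainBottom-bounds p))) p+b<k
... | no _ = ∈-++⁺ˡ (∈-map⁺ (outside ∷_) (chainBottom∈chainBottoms p))

AtMost Below : ∀ {k} → ℕ → Subset k → Set
AtMost a c = ∣ c ∣ ≤ a
Below a c = ∣ c ∣ < a

atMost? : ∀ {k} a → Decidable (AtMost {k} a)
atMost? a c = ∣ c ∣ ≤? a

below? : ∀ {k} a → Decidable (Below {k} a)
below? a c = ∣ c ∣ <? a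

chainBottoms-balanced : ∀ k → All (λ c → ∣ c ∣ + ∣ c ∣ ≤ k) (chainBottoms k)
chainBottoms-balanced zero = z≤n ∷ []
chainBottoms-balanced (suc k) =
  ++⁺ (map⁺ (All.map m≤n⇒m≤1+n (chainBottoms-balanced k)))
      (map⁺ (All.map (λ {c} → raise c) (all-filter isLong? (chainBottoms k))))
  where
  raise : ∀ (c : Subset k) → IsLong c → suc ∣ c ∣ + suc ∣ c ∣ ≤ suc k
  raise c long = s≤s (subst (_≤ k) (sym (+-suc (∣ c ∣) (∣ c ∣))) long)

length-atMost-chainBottoms-suc : ∀ k a → length (filter (atMost? a) (chainBottoms (suc k)))
  ≡ length (filter (atMost? a) (chainBottoms k)) + length (filter (below? a) (filter isLong? (chainBottoms k)))
length-atMost-chainBottoms-suc k a = begin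
  length (filter (atMost? a) (map (outside ∷_) bs ++ map (inside ∷_) (filter isLong? bs)))
    ≡⟨ cong length (filter-++ (atMost? a) (map (outside ∷_) bs) _) ⟩
  length (filter (atMost? a) (map (outside ∷_) bs) ++ filter (atMost? a) (map (inside ∷_) (filter isLong? bs)))
    ≡⟨ length-++ (filter (atMost? a) (map (outside ∷_) bs)) ⟩
  length (filter (atMost? a) (map (outside ∷_) bs)) + length (filter (atMost? a) (map (inside ∷_) (filter isLong? bs)))
    ≡⟨ cong₂ _+_ (length-filter-map (atMost? a) (outside ∷_) bs)
                 (length-filter-map (atMost? a) (inside ∷_) (filter isLong? bs)) ⟩
  length (filter (atMost? a) bs) + length (filter (below? a) (filter isLong? bs)) ∎
  where
  open ≡-Reasoning
  bs = chainBottoms k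

length-below-long : ∀ k a → a + a < k →
  length (filter (below? (suc a)) (filter isLong? (chainBottoms k))) ≡ length (filter (atMost? a) (chainBottoms k))
length-below-long k a a+a<k = cong length (trans
  (filter-filter-⊆ (below? (suc a)) isLong? (λ {c} → below⇒long {c}) (chainBottoms k))
  (filter-≐ (below? (suc a)) (atMost? a) (s≤s⁻¹ , s≤s) (chainBottoms k)))
  where
  below⇒long : Below (suc a) ⊆ᵘ IsLong {k}
  below⇒long c<1+a = ≤-<-trans (+-mono-≤ (s≤s⁻¹ c<1+a) (s≤s⁻¹ c<1+a)) a+a<k

length-atMost-odd : ∀ a → let k = suc (a + a) in
  length (filter (atMost? (suc a)) (chainBottoms k)) ≡ length (filter (atMost? a) (chainBottoms k))
length-atMost-odd a = trans (cong length (filter-all (atMost? (suc a)) (All.map m≤n⇒m≤1+n below)))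
                            (sym (cong length (filter-all (atMost? a) below)))
  where
  below : All (λ c → ∣ c ∣ ≤ a) (chainBottoms (suc (a + a)))
  below = All.map m+m≤1+n+n⇒m≤n (chainBottoms-balanced (suc (a + a)))

length-atMost-chainBottoms : ∀ k a → a + a ≤ k → length (filter (atMost? a) (chainBottoms k)) ≡ k C a
length-atMost-chainBottoms zero zero _ = refl
length-atMost-chainBottoms (suc k) zero _ = begin
  length (filter (atMost? 0) (chainBottoms (suc k)))
    ≡⟨ length-atMost-chainBottoms-suc k 0 ⟩
  length (filter (atMost? 0) (chainBottoms k)) + length (filter (below? 0) (filter isLong? (chainBottoms k)))
    ≡⟨ cong₂ _+_ (length-atMost-chainBottoms k 0 z≤n)
                 (cong length (filter-none (below? 0) (All.universal (λ _ ()) (filter isLong? (chainBottoms k))))) ⟩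
  1 + 0 ∎
  where open ≡-Reasoning
length-atMost-chainBottoms (suc k) (suc a) 2+2a≤1+k = begin
  length (filter (atMost? (suc a)) (chainBottoms (suc k)))
    ≡⟨ length-atMost-chainBottoms-suc k (suc a) ⟩
  length (filter (atMost? (suc a)) (chainBottoms k)) + length (filter (below? (suc a)) (filter isLong? (chainBottoms k)))
    ≡⟨ cong₂ _+_ top (trans (length-below-long k a a+a<k) (length-atMost-chainBottoms k a (<⇒≤ a+a<k))) ⟩
  k C suc a + k C a
    ≡⟨ +-comm (k C suc a) (k C a) ⟩
  k C a + k C suc a
    ≡⟨ nCk+nC[k+1]≡[n+1]C[k+1] k a ⟩
  suc k C suc a ∎
  where
  open ≡-Reasoning
  a+a<k : a + a < k
  a+a<k = s≤s⁻¹ (subst (_≤ suc k) (cong suc (+-suc a a)) 2+2a≤1+k)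
  k∸a≡1+a : suc (a + a) ∸ a ≡ suc a
  k∸a≡1+a = trans (cong (_∸ a) (sym (+-suc a a))) (m+n∸m≡n a (suc a))
  top : length (filter (atMost? (suc a)) (chainBottoms k)) ≡ k C suc a
  top with suc a + suc a ≤? k
  ... | yes 2+2a≤k = length-atMost-chainBottoms k (suc a) 2+2a≤k
  ... | no 2+2a≰k with ≤-antisym a+a<k (subst (k ≤_) (+-suc a a) (s≤s⁻¹ (≰⇒> 2+2a≰k)))
  ...   | refl = begin
    length (filter (atMost? (suc a)) (chainBottoms k)) ≡⟨ length-atMost-odd a ⟩
    length (filter (atMost? a) (chainBottoms k))       ≡⟨ length-atMost-chainBottoms k a (<⇒≤ a+a<k) ⟩
    k C a                                     ≡⟨ nCk≡nC[n∸k] (≤-trans (m≤m+n a a) (<⇒≤ a+a<k)) ⟩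
    k C (k ∸ a)                               ≡⟨ cong (k C_) k∸a≡1+a ⟩
    k C suc a                                 ∎

length-chainBottoms : ∀ k → length (chainBottoms k) ≡ k C ⌊ k /2⌋
length-chainBottoms k = trans
  (cong length (sym (filter-all (atMost? ⌊ k /2⌋) (All.map m+m≤n⇒m≤⌊n/2⌋ (chainBottoms-balanced k)))))
  (length-atMost-chainBottoms k ⌊ k /2⌋ (m≤⌊n/2⌋⇒m+m≤n ≤-refl))

length-longChainBottoms : ∀ k → length (filter isLong? (chainBottoms (suc k))) ≡ suc k C suc ⌈ k /2⌉
length-longChainBottoms k = begin
  length (filter isLong? (chainBottoms (suc k)))
    ≡⟨ cong length (filter-≐ isLong? (atMost? ⌊ k /2⌋) ((λ {c} → long⇒ {c}) , (λ {c} → ⇒long {c}))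
                             (chainBottoms (suc k))) ⟩
  length (filter (atMost? ⌊ k /2⌋) (chainBottoms (suc k)))
    ≡⟨ length-atMost-chainBottoms (suc k) ⌊ k /2⌋ (m≤n⇒m≤1+n (m≤⌊n/2⌋⇒m+m≤n ≤-refl)) ⟩
  suc k C ⌊ k /2⌋
    ≡⟨ nCk≡nC[n∸k] (m≤n⇒m≤1+n (⌊n/2⌋≤n k)) ⟩
  suc k C (suc k ∸ ⌊ k /2⌋)
    ≡⟨ cong (suc k C_) (trans (+-∸-assoc 1 (⌊n/2⌋≤n k)) (cong suc (n∸⌊n/2⌋≡⌈n/2⌉ k))) ⟩
  suc k C suc ⌈ k /2⌉ ∎
  where
  open ≡-Reasoning
  long⇒ : IsLong ⊆ᵘ AtMost ⌊ k /2⌋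
  long⇒ = m+m≤n⇒m≤⌊n/2⌋ ∘ s≤s⁻¹
  ⇒long : AtMost ⌊ k /2⌋ ⊆ᵘ IsLong {suc k}
  ⇒long = s≤s ∘ m≤⌊n/2⌋⇒m+m≤n

answers : ∀ {k n r} → Queries k n r → Fin r → Fin n → Subset k
answers Q i d = tabulate λ j → does (Q j d ≟ i)

module _ {k n r} {Q : Queries k n r} {i : Fin r} where

  ∈-answers⁺ : ∀ {d j} → Q j d ≡ i → j ∈ answers Q i d
  ∈-answers⁺ {d} {j} Qjd≡i = lookup⇒[]= j _ (trans (lookup∘tabulate _ j) (dec-true (Q j d ≟ i) Qjd≡i))

  ∈-answers⁻ : ∀ {d j} → j ∈ answers Q i d → Q j d ≡ i
  ∈-answers⁻ {d} {j} j∈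
    with Q j d ≟ i | trans (sym (lookup∘tabulate (λ j → does (Q j d ≟ i)) j)) ([]=⇒lookup j∈)
  ... | yes Qjd≡i | _ = Qjd≡i

  identifies⇒⊆⇒≡ : ∀ {d} → Identifies Q i d → ∀ {x} → answers Q i d ⊆ answers Q i x → x ≡ d
  identifies⇒⊆⇒≡ identifies {x} d⊆x = identifies x λ j Qjd≡i → ∈-answers⁻ (d⊆x (∈-answers⁺ Qjd≡i))

  ⊆⇒≡⇒identifies : ∀ {d} → (∀ x → answers Q i d ⊆ answers Q i x → x ≡ d) → Identifies Q i d
  ⊆⇒≡⇒identifies unique x answer⇒ = unique x λ j∈ → ∈-answers⁺ (answer⇒ _ (∈-answers⁻ j∈))

samePlayer-sameChain⇒≡ : ∀ {k n r} {Q : Queries k n r} {i d d'} → Identifies Q i d → Identifies Q i d' →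
  chainBottom (answers Q i d) ≡ chainBottom (answers Q i d') → d ≡ d'
samePlayer-sameChain⇒≡ {Q = Q} {i} {d} {d'} identifies identifies' same
  with ≤-total (∣ answers Q i d ∣) (∣ answers Q i d' ∣)
... | inj₁ ≤ = sym (identifies⇒⊆⇒≡ identifies (sameChain⇒⊆ _ _ same ≤))
... | inj₂ ≥ = identifies⇒⊆⇒≡ identifies' (sameChain⇒⊆ _ _ (sym same) ≥)

module _ {k n r} (Q : Queries k n r) (solves : SolvesModel2 Q) where

  playerAndChain : Fin n → Fin r × Subset k
  playerAndChain d = proj₁ (solves d) , chainBottom (answers Q (proj₁ (solves d)) d)

  playerAndChain-injective : Injective _≡_ _≡_ playerAndChain
  playerAndChain-injective {d} {d'} eq with solves d | solves d' | ,-injectiveˡ eq | ,-injectiveʳ eq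
  ... | i , identifies | .i , identifies' | refl | same = samePlayer-sameChain⇒≡ identifies identifies' same

  n≤r*kC⌊k/2⌋ : n ≤ r * (k C ⌊ k /2⌋)
  n≤r*kC⌊k/2⌋ = subst (n ≤_) length-target (∈-injective⇒≤length playerAndChain playerAndChain-injective
    λ d → ∈-cartesianProduct⁺ (∈-allFin _) (chainBottom∈chainBottoms (answers Q (proj₁ (solves d)) d)))
    where
    length-target : length (cartesianProduct (allFin r) (chainBottoms k)) ≡ r * (k C ⌊ k /2⌋)
    length-target = trans (length-cartesianProduct (allFin r) (chainBottoms k))
                          (cong₂ _*_ (length-tabulate {n = r} id) (length-chainBottoms k))

≢zero⇒≡one : ∀ {c : Fin 2} → c ≢ zero → c ≡ suc zero
≢zero⇒≡one {zero} c≢0 = contradiction refl c≢0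
≢zero⇒≡one {suc zero} _ = refl

labelIf : ∀ {P : Set} → Dec P → Fin 2 → Fin 2
labelIf (yes _) i = i
labelIf (no _) _ = zero

labelIf-injective : ∀ {P : Set} (P? : Dec P) → P → ∀ {i i'} → labelIf P? i ≡ labelIf P? i' → i ≡ i'
labelIf-injective (yes _) _ eq = eq
labelIf-injective (no ¬p) p = contradiction p ¬p

-- With two players the answer sets of C₁ are the complements of those of C₀, so both are
-- read off inZero.
module _ {k n} (Q : Queries k n 2) (solves : SolvesModel2 Q) where

  private
    inZero : Fin n → Subset k
    inZero = answers Q zero

    player : Fin n → Fin 2
    player d = proj₁ (solves d)

  identifies-one⇒⊇⇒≡ : ∀ {d x} → Identifies Q (suc zero) d → inZero x ⊆ inZero d → x ≡ d
  identifies-one⇒⊇⇒≡ {d} {x} identifies x⊆d = identifies x λ j Qjd≡1 →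
    ≢zero⇒≡one λ Qjx≡0 →
      0≢1+n (trans (sym (∈-answers⁻ {Q = Q} (x⊆d (∈-answers⁺ {Q = Q} Qjx≡0)))) Qjd≡1)

  samePlayer-⊆⇒≡ : ∀ {d d'} → player d ≡ player d' → inZero d ⊆ inZero d' → d ≡ d'
  samePlayer-⊆⇒≡ {d} {d'} same d⊆d' with solves d | solves d'
  ... | zero , identifies | _ , _ = sym (identifies⇒⊆⇒≡ identifies d⊆d')
  ... | suc zero , _ | suc zero , identifies' = identifies-one⇒⊇⇒≡ identifies' d⊆d'
  samePlayer-⊆⇒≡ () _ | suc zero , _ | zero , _

  inZero-injective : Injective _≡_ _≡_ inZero
  inZero-injective {d} {d'} eq with solves d
  ... | zero , identifies = sym (identifies⇒⊆⇒≡ identifies (⊆-reflexive eq))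
  ... | suc zero , identifies = sym (identifies-one⇒⊇⇒≡ identifies (⊆-reflexive (sym eq)))

  samePlayer-sameChain⇒≡₂ : ∀ {d d'} → player d ≡ player d' →
    chainBottom (inZero d) ≡ chainBottom (inZero d') → d ≡ d'
  samePlayer-sameChain⇒≡₂ {d} {d'} same sameChain with ≤-total (∣ inZero d ∣) (∣ inZero d' ∣)
  ... | inj₁ ≤ = samePlayer-⊆⇒≡ same (sameChain⇒⊆ _ _ sameChain ≤)
  ... | inj₂ ≥ = sym (samePlayer-⊆⇒≡ (sym same) (sameChain⇒⊆ _ _ (sym sameChain) ≥))

  -- A chain meets the elements identified by one player at most once, and a one-member
  -- chain meets at most one element at all.
  chainAndLabel : Fin n → Subset k × Fin 2
  chainAndLabel d = chainBottom (inZero d) , labelIf (isLong? (chainBottom (inZero d))) (player d)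

  chainAndLabel-injective : Injective _≡_ _≡_ chainAndLabel
  chainAndLabel-injective {d} {d'} eq = case isLong? c of λ where
      (yes long) → samePlayer-sameChain⇒≡₂ (labelIf-injective (isLong? c) long sameLabel) sameChain
      (no short) → inZero-injective (shortChain⇒≡ _ _ short sameChain)
    where
    c = chainBottom (inZero d)
    sameChain = ,-injectiveˡ eq
    sameLabel : labelIf (isLong? c) (player d) ≡ labelIf (isLong? c) (player d')
    sameLabel = trans (,-injectiveʳ eq) (cong (λ c → labelIf (isLong? c) (player d')) (sym sameChain))

  chainAndLabel∈ : ∀ d → chainAndLabel d ∈ˡ
    map (_, zero) (chainBottoms k) ++ map (_, suc zero) (filter isLong? (chainBottoms k))
  chainAndLabel∈ d = labelled∈ (isLong? (chainBottom (inZero d))) (player d) (chainBottom∈chainBottoms (inZero d))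
    where
    labelled∈ : ∀ {c} (long? : Dec (IsLong c)) i → c ∈ˡ chainBottoms k → (c , labelIf long? i) ∈ˡ
      map (_, zero) (chainBottoms k) ++ map (_, suc zero) (filter isLong? (chainBottoms k))
    labelled∈ (yes long) (suc zero) c∈ = ∈-++⁺ʳ _ (∈-map⁺ (_, suc zero) (∈-filter⁺ isLong? c∈ long))
    labelled∈ (yes _) zero c∈ = ∈-++⁺ˡ (∈-map⁺ (_, zero) c∈)
    labelled∈ (no _) _ c∈ = ∈-++⁺ˡ (∈-map⁺ (_, zero) c∈)

  n≤kC⌊k/2⌋+kC[1+⌊k/2⌋] : 1 ≤ k → n ≤ k C ⌊ k /2⌋ + k C suc ⌊ k /2⌋
  n≤kC⌊k/2⌋+kC[1+⌊k/2⌋] (s≤s _) = subst (n ≤_) length-target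
    (∈-injective⇒≤length chainAndLabel chainAndLabel-injective chainAndLabel∈)
    where
    length-target : length (map (_, zero) (chainBottoms k) ++ map (_, suc zero) (filter isLong? (chainBottoms k)))
                  ≡ k C ⌊ k /2⌋ + k C suc ⌊ k /2⌋
    length-target = trans (length-++ (map (_, zero) (chainBottoms k)))
      (cong₂ _+_ (trans (length-map _ (chainBottoms k)) (length-chainBottoms k))
                 (trans (length-map _ (filter isLong? (chainBottoms k))) (length-longChainBottoms (pred k))))

-- An element d is the cell (row d , column d) of the grid of answer pairs; it is the only
-- element of its row, of its column, or of a diagonal cell.
module _ {n r} (Q : Queries 2 n (suc r)) (solves : SolvesModel2 Q) where

  private
    row column : Fin n → Fin (suc r)
    row = Q zero
    column = Q (suc zero)

  AloneInColumn : Fin n → Set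
  AloneInColumn d = ∀ x → column x ≡ column d → x ≡ d

  aloneInColumn? : Decidable AloneInColumn
  aloneInColumn? d = all? λ x → (column x ≟ column d) →-dec (x ≟ d)

  identifiedOffRow⇒alone : ∀ {i d} → Identifies Q i d → row d ≢ i → AloneInColumn d
  identifiedOffRow⇒alone identifies row≢i x same = identifies x λ where
    zero row≡i → contradiction row≡i row≢i
    (suc zero) column≡i → trans same column≡i

  notAlone⇒rowIdentifies : ∀ {d} → ¬ AloneInColumn d → ∀ x → row x ≡ row d →
    (column d ≡ row d → column x ≡ column d) → x ≡ d
  notAlone⇒rowIdentifies {d} notAlone x sameRow onDiagonal with solves d
  ... | i , identifies with row d ≟ i
  ...   | no row≢i = contradiction (identifiedOffRow⇒alone identifies row≢i) notAlone
  ...   | yes row≡i = identifies x λ where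
    zero row≡i' → trans sameRow row≡i'
    (suc zero) column≡i → trans (onDiagonal (trans column≡i (sym row≡i))) column≡i

  notAlone-sameRow⇒≡ : ∀ {d d'} → ¬ AloneInColumn d → ¬ AloneInColumn d' → row d ≡ row d' → d ≡ d'
  notAlone-sameRow⇒≡ {d} {d'} notAlone notAlone' sameRow with column d ≟ row d | column d' ≟ row d'
  ... | no offDiagonal | _ = sym (notAlone⇒rowIdentifies notAlone d' (sym sameRow) (flip contradiction offDiagonal))
  ... | yes _ | no offDiagonal' = notAlone⇒rowIdentifies notAlone' d sameRow (flip contradiction offDiagonal')
  ... | yes diagonal | yes diagonal' = sym (notAlone⇒rowIdentifies notAlone d' (sym sameRow)
          λ _ → trans diagonal' (trans (sym sameRow) (sym diagonal)))

  private
    place : ∀ {d} → Dec (AloneInColumn d) → Fin (suc r) ⊎ Fin (suc r)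
    place {d} (yes _) = inj₂ (column d)
    place {d} (no _) = inj₁ (row d)

    place-injective : ∀ {d d'} (alone? : Dec (AloneInColumn d)) (alone'? : Dec (AloneInColumn d')) →
      place alone? ≡ place alone'? → d ≡ d'
    place-injective (yes alone) (yes _) eq = sym (alone _ (sym (inj₂-injective eq)))
    place-injective (no notAlone) (no notAlone') eq = notAlone-sameRow⇒≡ notAlone notAlone' (inj₁-injective eq)
    place-injective (yes _) (no _) ()
    place-injective (no _) (yes _) ()

    place-alone : ∀ {d} (alone? : Dec (AloneInColumn d)) → AloneInColumn d → ∀ {y} → place alone? ≢ inj₁ y
    place-alone (yes _) _ ()
    place-alone (no notAlone) alone _ = notAlone alone

    place≡inj₂ : ∀ {d c} (alone? : Dec (AloneInColumn d)) → place alone? ≡ inj₂ c →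
      AloneInColumn d × column d ≡ c
    place≡inj₂ (yes alone) eq = alone , inj₂-injective eq

  position : Fin n → Fin (suc r) ⊎ Fin (suc r)
  position d = place (aloneInColumn? d)

  position-avoids : ∃ λ y → ∀ d → position d ≢ y
  position-avoids with all? aloneInColumn?
  ... | yes allAlone = inj₁ zero , λ d → place-alone (aloneInColumn? d) (allAlone d)
  ... | no notAllAlone with ¬∀⟶∃¬ n AloneInColumn aloneInColumn? notAllAlone
  ...   | e , notAlone = inj₂ (column e) , λ d eq →
    let alone , sameColumn = place≡inj₂ (aloneInColumn? d) eq
    in notAlone (subst AloneInColumn (sym (alone e (sym sameColumn))) alone)

  n≤r+[1+r] : n ≤ r + suc r
  n≤r+[1+r] = injective-avoiding⇒≤ (join (suc r) (suc r) ∘ position)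
    (λ {d} {d'} → place-injective (aloneInColumn? d) (aloneInColumn? d') ∘ join-injective (suc r) (suc r))
    λ d → proj₂ position-avoids d ∘ join-injective (suc r) (suc r)

fromCodewords : ∀ {k n r} → (Fin n → Vec (Fin r) k) → Queries k n r
fromCodewords word j x = Vec.lookup (word x) j

colorClass : ∀ {k r} → Fin r → Vec (Fin r) k → Subset k
colorClass i = Vec.map λ c → does (c ≟ i)

answers-fromCodewords : ∀ {k n r} (word : Fin n → Vec (Fin r) k) i x →
  answers (fromCodewords word) i x ≡ colorClass i (word x)
answers-fromCodewords word i x =
  trans (tabulate-∘ _ (Vec.lookup (word x))) (cong (colorClass i) (tabulate∘lookup (word x)))

∣colorClass-∷∣≤ : ∀ {k r} {c : Fin r} x (w : Vec (Fin r) k) →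
  ∣ colorClass c (x ∷ w) ∣ ≤ suc ∣ colorClass c w ∣
∣colorClass-∷∣≤ {c = c} x w with does (x ≟ c)
... | true = ≤-refl
... | false = n≤1+n _

∣colorClass-∷∣-other : ∀ {k r} {c x : Fin r} (w : Vec (Fin r) k) → x ≢ c →
  ∣ colorClass c (x ∷ w) ∣ ≡ ∣ colorClass c w ∣
∣colorClass-∷∣-other {c = c} {x} w x≢c rewrite dec-false (x ≟ c) x≢c = refl

toColor : Bool → Fin 2
toColor inside = suc zero
toColor outside = zero

colorClass-one : ∀ {k} (p : Subset k) → colorClass (suc zero) (Vec.map toColor p) ≡ p
colorClass-one [] = refl
colorClass-one (inside ∷ p) = cong (inside ∷_) (colorClass-one p)
colorClass-one (outside ∷ p) = cong (outside ∷_) (colorClass-one p)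

colorClass-zero : ∀ {k} (p : Subset k) → colorClass zero (Vec.map toColor p) ≡ ∁ p
colorClass-zero [] = refl
colorClass-zero (inside ∷ p) = cong (outside ∷_) (colorClass-zero p)
colorClass-zero (outside ∷ p) = cong (inside ∷_) (colorClass-zero p)

-- C₁ identifies the subsets of size m + 1 and C₀ those of size m.
module TwoLevels (k m : ℕ) where

  levels : List (Subset k)
  levels = subsetsOfSize k m ++ subsetsOfSize k (suc m)

  levels-unique : Unique levels
  levels-unique = Unique.++⁺ (subsetsOfSize-unique k m) (subsetsOfSize-unique k (suc m))
    λ (∈m , ∈1+m) → 1+n≢n (trans (sym (All.lookup (∣subsetsOfSize∣ k (suc m)) ∈1+m))
                                 (All.lookup (∣subsetsOfSize∣ k m) ∈m))

  ∣levels∣ : All (λ p → ∣ p ∣ ≡ m ⊎ ∣ p ∣ ≡ suc m) levels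
  ∣levels∣ = ++⁺ (All.map inj₁ (∣subsetsOfSize∣ k m)) (All.map inj₂ (∣subsetsOfSize∣ k (suc m)))

  element : Fin (length levels) → Subset k
  element = List.lookup levels

  element-injective : Injective _≡_ _≡_ element
  element-injective = lookup-injective levels-unique

  ∣element∣ : ∀ d → ∣ element d ∣ ≡ m ⊎ ∣ element d ∣ ≡ suc m
  ∣element∣ d = All.lookup ∣levels∣ (∈-lookup d)

  ∣element∣≤1+m : ∀ x → ∣ element x ∣ ≤ suc m
  ∣element∣≤1+m x = [ m≤n⇒m≤1+n ∘ ≤-reflexive , ≤-reflexive ]′ (∣element∣ x)

  m≤∣element∣ : ∀ x → m ≤ ∣ element x ∣
  m≤∣element∣ x = [ ≤-reflexive ∘ sym , ≤-trans (n≤1+n m) ∘ ≤-reflexive ∘ sym ]′ (∣element∣ x)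

  queries : Queries k (length levels) 2
  queries = fromCodewords (Vec.map toColor ∘ element)

  answers-one : ∀ x → answers queries (suc zero) x ≡ element x
  answers-one x = trans (answers-fromCodewords (Vec.map toColor ∘ element) _ x) (colorClass-one (element x))

  answers-zero : ∀ x → answers queries zero x ≡ ∁ (element x)
  answers-zero x = trans (answers-fromCodewords (Vec.map toColor ∘ element) _ x) (colorClass-zero (element x))

  solves : SolvesModel2 queries
  solves d with ∣element∣ d
  ... | inj₂ ∣d∣≡1+m = suc zero , ⊆⇒≡⇒identifies λ x d⊆x → sym (element-injective (⊆∧∣∣≥⇒≡
    (subst₂ _⊆_ (answers-one d) (answers-one x) d⊆x) (subst (_ ≤_) (sym ∣d∣≡1+m) (∣element∣≤1+m x))))
  ... | inj₁ ∣d∣≡m = zero , ⊆⇒≡⇒identifies λ x d⊆x → element-injective (⊆∧∣∣≥⇒≡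
    (∁p⊆∁q⇒p⊇q (subst₂ _⊆_ (answers-zero d) (answers-zero x) d⊆x)) (subst (_≤ _) (sym ∣d∣≡m) (m≤∣element∣ x)))

  solvable : Solvable k 2 (k C m + k C suc m)
  solvable = subst (Solvable k 2) length-levels (queries , solves)
    where
    length-levels : length levels ≡ k C m + k C suc m
    length-levels = trans (length-++ (subsetsOfSize k m))
                          (cong₂ _+_ (length-subsetsOfSize k m) (length-subsetsOfSize k (suc m)))

-- i on p, a on the first position outside p and b on the others: when a ≢ b, each colour
-- other than i is used at most max 1 (∣ ∁ p ∣ ∸ 1) times.
paint : ∀ {k r} → Fin r → Fin r → Fin r → Subset k → Vec (Fin r) k
paint i a b [] = []
paint i a b (inside ∷ p) = i ∷ paint i a b p
paint i a b (outside ∷ p) = a ∷ paint i b b p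

colorClass-paint-self : ∀ {k r} {i a b : Fin r} → a ≢ i → b ≢ i → (p : Subset k) →
  colorClass i (paint i a b p) ≡ p
colorClass-paint-self a≢i b≢i [] = refl
colorClass-paint-self {i = i} a≢i b≢i (inside ∷ p) =
  cong₂ _∷_ (dec-true (i ≟ i) refl) (colorClass-paint-self a≢i b≢i p)
colorClass-paint-self {i = i} {a} a≢i b≢i (outside ∷ p) =
  cong₂ _∷_ (dec-false (a ≟ i) a≢i) (colorClass-paint-self b≢i b≢i p)

∣colorClass-paint∣≤∣∁∣ : ∀ {k r} {i a b c : Fin r} → i ≢ c → (p : Subset k) →
  ∣ colorClass c (paint i a b p) ∣ ≤ ∣ ∁ p ∣
∣colorClass-paint∣≤∣∁∣ i≢c [] = z≤n
∣colorClass-paint∣≤∣∁∣ {i = i} {a} {b} i≢c (inside ∷ p) =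
  ≤-trans (≤-reflexive (∣colorClass-∷∣-other (paint i a b p) i≢c)) (∣colorClass-paint∣≤∣∁∣ i≢c p)
∣colorClass-paint∣≤∣∁∣ {i = i} {a} {b} i≢c (outside ∷ p) =
  ≤-trans (∣colorClass-∷∣≤ a (paint i b b p)) (s≤s (∣colorClass-paint∣≤∣∁∣ i≢c p))

∣colorClass-paint∣≤∣∁∣∸1 : ∀ {k r} {i a b c : Fin r} → i ≢ c → a ≢ c → (p : Subset k) →
  ∣ colorClass c (paint i a b p) ∣ ≤ ∣ ∁ p ∣ ∸ 1
∣colorClass-paint∣≤∣∁∣∸1 i≢c a≢c [] = z≤n
∣colorClass-paint∣≤∣∁∣∸1 {i = i} {a} {b} i≢c a≢c (inside ∷ p) =
  ≤-trans (≤-reflexive (∣colorClass-∷∣-other (paint i a b p) i≢c)) (∣colorClass-paint∣≤∣∁∣∸1 i≢c a≢c p)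
∣colorClass-paint∣≤∣∁∣∸1 {i = i} {a} {b} i≢c a≢c (outside ∷ p) =
  ≤-trans (≤-reflexive (∣colorClass-∷∣-other (paint i b b p) a≢c)) (∣colorClass-paint∣≤∣∁∣ i≢c p)

∣colorClass-paint∣≡0 : ∀ {k r} {i a b c : Fin r} → i ≢ c → a ≢ c → b ≢ c → (p : Subset k) →
  ∣ colorClass c (paint i a b p) ∣ ≡ 0
∣colorClass-paint∣≡0 i≢c a≢c b≢c [] = refl
∣colorClass-paint∣≡0 {i = i} {a} {b} i≢c a≢c b≢c (inside ∷ p) =
  trans (∣colorClass-∷∣-other (paint i a b p) i≢c) (∣colorClass-paint∣≡0 i≢c a≢c b≢c p)
∣colorClass-paint∣≡0 {i = i} {a} {b} i≢c a≢c b≢c (outside ∷ p) =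
  trans (∣colorClass-∷∣-other (paint i b b p) a≢c) (∣colorClass-paint∣≡0 i≢c b≢c b≢c p)

∣colorClass-paint∣≤1 : ∀ {k r} {i a b c : Fin r} → i ≢ c → b ≢ c → (p : Subset k) →
  ∣ colorClass c (paint i a b p) ∣ ≤ 1
∣colorClass-paint∣≤1 i≢c b≢c [] = z≤n
∣colorClass-paint∣≤1 {i = i} {a} {b} i≢c b≢c (inside ∷ p) =
  ≤-trans (≤-reflexive (∣colorClass-∷∣-other (paint i a b p) i≢c)) (∣colorClass-paint∣≤1 i≢c b≢c p)
∣colorClass-paint∣≤1 {i = i} {a} {b} i≢c b≢c (outside ∷ p) =
  ≤-trans (∣colorClass-∷∣≤ a (paint i b b p)) (s≤s (≤-reflexive (∣colorClass-paint∣≡0 i≢c b≢c b≢c p)))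

∣colorClass-paint∣<∣p∣ : ∀ {k r} {i a b c : Fin r} → a ≢ b → i ≢ c → (p : Subset k) →
  2 ≤ ∣ p ∣ → ∣ ∁ p ∣ ≤ ∣ p ∣ → ∣ colorClass c (paint i a b p) ∣ < ∣ p ∣
∣colorClass-paint∣<∣p∣ {a = a} {b} {c} a≢b i≢c p 2≤∣p∣ ∣∁p∣≤∣p∣ with a ≟ c
... | yes refl = <-≤-trans (s≤s (∣colorClass-paint∣≤1 i≢c (a≢b ∘ sym) p)) 2≤∣p∣
... | no a≢c = begin-strict
  ∣ colorClass c (paint _ a b p) ∣ ≤⟨ ∣colorClass-paint∣≤∣∁∣∸1 i≢c a≢c p ⟩
  ∣ ∁ p ∣ ∸ 1                       ≤⟨ ∸-monoˡ-≤ 1 ∣∁p∣≤∣p∣ ⟩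
  ∣ p ∣ ∸ 1                         <⟨ ∸-monoʳ-< (s≤s z≤n) (≤-trans (s≤s z≤n) 2≤∣p∣) ⟩
  ∣ p ∣ ∸ 0                         ∎
  where open ≤-Reasoning

-- At least three colours give second i and third i, distinct and different from i;
-- k ≥ 3 makes ⌈ k /2⌉ ≥ 2.
module Painted (r' k : ℕ) (3≤k : 3 ≤ k) where

  colors : ℕ
  colors = suc (suc (suc r'))

  halfSubsets : List (Subset k)
  halfSubsets = subsetsOfSize k ⌈ k /2⌉

  player : Fin (colors * length halfSubsets) → Fin colors
  player x = proj₁ (remQuot {colors} (length halfSubsets) x)

  subset : Fin (colors * length halfSubsets) → Subset k
  subset x = List.lookup halfSubsets (proj₂ (remQuot {colors} (length halfSubsets) x))

  second third : Fin colors → Fin colors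
  second i = punchIn i zero
  third i = punchIn i (suc zero)

  word : Fin (colors * length halfSubsets) → Vec (Fin colors) k
  word x = paint (player x) (second (player x)) (third (player x)) (subset x)

  queries : Queries k (colors * length halfSubsets) colors
  queries = fromCodewords word

  ∣subset∣ : ∀ x → ∣ subset x ∣ ≡ ⌈ k /2⌉
  ∣subset∣ x =
    All.lookup (∣subsetsOfSize∣ k ⌈ k /2⌉) (∈-lookup (proj₂ (remQuot {colors} (length halfSubsets) x)))

  ∣∁subset∣≤∣subset∣ : ∀ x → ∣ ∁ (subset x) ∣ ≤ ∣ subset x ∣
  ∣∁subset∣≤∣subset∣ x = begin
    ∣ ∁ (subset x) ∣         ≡⟨ ∣∁p∣≡n∸∣p∣ (subset x) ⟩
    k ∸ ∣ subset x ∣         ≡⟨ cong (k ∸_) (∣subset∣ x) ⟩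
    k ∸ ⌈ k /2⌉              ≡⟨ cong (_∸ ⌈ k /2⌉) (sym (⌊n/2⌋+⌈n/2⌉≡n k)) ⟩
    ⌊ k /2⌋ + ⌈ k /2⌉ ∸ ⌈ k /2⌉ ≡⟨ m+n∸n≡m ⌊ k /2⌋ ⌈ k /2⌉ ⟩
    ⌊ k /2⌋                  ≤⟨ ⌊n/2⌋≤⌈n/2⌉ k ⟩
    ⌈ k /2⌉                  ≡⟨ sym (∣subset∣ x) ⟩
    ∣ subset x ∣             ∎
    where open ≤-Reasoning

  answers-own : ∀ x → answers queries (player x) x ≡ subset x
  answers-own x = trans (answers-fromCodewords word _ x)
    (colorClass-paint-self (punchInᵢ≢i (player x) zero) (punchInᵢ≢i (player x) (suc zero)) (subset x))

  ∣answers-other∣ : ∀ {c} x → player x ≢ c → ∣ answers queries c x ∣ < ∣ subset x ∣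
  ∣answers-other∣ {c} x player≢c = subst (λ p → ∣ p ∣ < ∣ subset x ∣) (sym (answers-fromCodewords word c x))
    (∣colorClass-paint∣<∣p∣ (λ eq → 0≢1+n (punchIn-injective (player x) zero (suc zero) eq)) player≢c (subset x)
      (subst (2 ≤_) (sym (∣subset∣ x)) (⌈n/2⌉-mono 3≤k)) (∣∁subset∣≤∣subset∣ x))

  sameSize : ∀ x d → ∣ subset x ∣ ≡ ∣ subset d ∣
  sameSize x d = trans (∣subset∣ x) (sym (∣subset∣ d))

  samePlayer-nested⇒≡ : ∀ {d x} → player x ≡ player d → subset d ⊆ subset x → x ≡ d
  samePlayer-nested⇒≡ {d} {x} samePlayer d⊆x = remQuot-injective {colors} (length halfSubsets)
    (cong₂ _,_ samePlayer (sym (lookup-injective (subsetsOfSize-unique k ⌈ k /2⌉)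
      (⊆∧∣∣≥⇒≡ d⊆x (≤-reflexive (sameSize x d))))))

  solves : SolvesModel2 queries
  solves d = player d , ⊆⇒≡⇒identifies λ x d⊆x → case player x ≟ player d of λ where
    (yes samePlayer) → samePlayer-nested⇒≡ samePlayer
      (subst₂ _⊆_ (answers-own d) (subst (λ i → answers queries i x ≡ subset x) samePlayer (answers-own x)) d⊆x)
    (no otherPlayer) → contradiction (p⊆q⇒∣p∣≤∣q∣ d⊆x) (<⇒≱ (begin-strict
      ∣ answers queries (player d) x ∣ <⟨ ∣answers-other∣ x otherPlayer ⟩
      ∣ subset x ∣                    ≡⟨ sameSize x d ⟩
      ∣ subset d ∣                    ≡⟨ cong ∣_∣ (answers-own d) ⟨
      ∣ answers queries (player d) d ∣ ∎))
      where open ≤-Reasoning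

  solvable : Solvable k colors (colors * (k C (k / 2)))
  solvable = subst (λ N → Solvable k colors (colors * N)) length-halfSubsets (queries , solves)
    where
    length-halfSubsets : length halfSubsets ≡ k C (k / 2)
    length-halfSubsets = trans (length-subsetsOfSize k ⌈ k /2⌉)
      (trans (sym (nC⌊n/2⌋≡nC⌈n/2⌉ k)) (cong (k C_) (sym (n/2≡⌊n/2⌋ k))))

-- The 2r − 1 cells of the first row and the first column of the grid.
module Cross (r' : ℕ) where

  axisCell : Fin r' ⊎ Fin r' → Fin (suc r') × Fin (suc r')
  axisCell (inj₁ i) = suc i , zero
  axisCell (inj₂ j) = zero , suc j

  cell : Fin (suc (r' + r')) → Fin (suc r') × Fin (suc r')
  cell zero = zero , zero
  cell (suc y) = axisCell (splitAt r' y)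

  queries : Queries 2 (suc (r' + r')) (suc r')
  queries zero x = proj₁ (cell x)
  queries (suc zero) x = proj₂ (cell x)

  joined : ∀ {y z} → splitAt r' y ≡ z → join r' r' z ≡ y
  joined split = trans (cong (join r' r') (sym split)) (join-splitAt r' r' _)

  origin-unique : ∀ x → cell x ≡ (zero , zero) → x ≡ zero
  origin-unique zero _ = refl
  origin-unique (suc y) eq with splitAt r' y
  ... | inj₁ _ = contradiction (,-injectiveˡ eq) λ ()
  ... | inj₂ _ = contradiction (,-injectiveʳ eq) λ ()

  row-unique : ∀ x {i} → proj₁ (cell x) ≡ suc i → x ≡ suc (join r' r' (inj₁ i))
  row-unique zero ()
  row-unique (suc y) row≡ with splitAt r' y in split
  ... | inj₁ _ = cong suc (sym (joined (trans split (cong inj₁ (suc-injective row≡)))))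
  ... | inj₂ _ = contradiction row≡ λ ()

  column-unique : ∀ x {j} → proj₂ (cell x) ≡ suc j → x ≡ suc (join r' r' (inj₂ j))
  column-unique zero ()
  column-unique (suc y) column≡ with splitAt r' y in split
  ... | inj₁ _ = contradiction column≡ λ ()
  ... | inj₂ _ = cong suc (sym (joined (trans split (cong inj₂ (suc-injective column≡)))))

  solves : SolvesModel2 queries
  solves zero = zero , λ x same → origin-unique x (cong₂ _,_ (same zero refl) (same (suc zero) refl))
  solves (suc y) with splitAt r' y in split
  ... | inj₁ i = suc i , λ x same →
    trans (row-unique x (same zero (cong (proj₁ ∘ axisCell) split))) (cong suc (joined split))
  ... | inj₂ j = suc j , λ x same →
    trans (column-unique x (same (suc zero) (cong (proj₂ ∘ axisCell) split))) (cong suc (joined split))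

  solvable : Solvable 2 (suc r') (2 * suc r' ∸ 1)
  solvable = subst (Solvable 2 (suc r')) size (queries , solves)
    where
    size : suc (r' + r') ≡ 2 * suc r' ∸ 1
    size = trans (sym (+-suc r' r')) (cong (λ m → r' + suc m) (sym (+-identityʳ r')))

isG2-manyPlayers : ∀ r' k → 3 ≤ k → let r = suc (suc (suc r')) in IsG2 k r (r * (k C (k / 2)))
isG2-manyPlayers r' k 3≤k = Painted.solvable r' k 3≤k , λ n (Q , solves) →
  subst (λ h → n ≤ suc (suc (suc r')) * (k C h)) (sym (n/2≡⌊n/2⌋ k)) (n≤r*kC⌊k/2⌋ Q solves)

isG2-twoPlayers : ∀ k → 1 ≤ k → IsG2 k 2 (k C (k / 2) + k C suc (k / 2))
isG2-twoPlayers k 1≤k = TwoLevels.solvable k (k / 2) , λ n (Q , solves) →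
  subst (λ h → n ≤ k C h + k C suc h) (sym (n/2≡⌊n/2⌋ k)) (n≤kC⌊k/2⌋+kC[1+⌊k/2⌋] Q solves 1≤k)

isG2-twoQueries : ∀ r' → IsG2 2 (suc r') (2 * suc r' ∸ 1)
isG2-twoQueries r' = Cross.solvable r' , λ n (Q , solves) →
  subst (n ≤_) (cong (r' +_) (sym (+-identityʳ (suc r')))) (n≤r+[1+r] Q solves)

theorem2 : ∀ (k r : ℕ) → 1 ≤ k → 2 ≤ r →
    ((3 ≤ k → r ≢ 2 → IsG2 k r (r * (k C (k / 2))))
    × (r ≡ 2 → IsG2 k r ((k C (k / 2)) + (k C (suc (k / 2)))))
    × (k ≡ 2 → IsG2 k r (2 * r ∸ 1)))
theorem2 k 2 1≤k _ =
  (λ _ 2≢2 → contradiction refl 2≢2) , (λ _ → isG2-twoPlayers k 1≤k) , λ { refl → isG2-twoQueries 1 }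
theorem2 k (suc (suc (suc r'))) _ _ =
  (λ 3≤k _ → isG2-manyPlayers r' k 3≤k) , (λ ()) , λ { refl → isG2-twoQueries (suc (suc r')) }
theorem2 k 1 _ (s≤s ())
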